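{- For all store types $\sigma,\sigma'$: if $\sigma\le_S\sigma'$ then $\mathrm{dom}(\sigma)\supseteq\mathrm{dom}(\sigma')$.
   Context: Fix a countably infinite set $\mathbf{L}$ of locations. Value types $\delta ::= \delta\to\tau \mid \delta\wedge\delta \mid \omega_D$; store types $\sigma ::= \langle \ell:\delta\rangle \mid \sigma\wedge\sigma \mid \omega_S$ ($\ell\in\mathbf{L}$); computation types $\kappa ::= \delta\times\sigma \mid \kappa\wedge\kappa\mid\omega_C$; configuration types $\tau ::= \sigma\to\kappa \mid \tau\wedge\tau \mid \omega_T$. For each sort $A$, $\le_A$ is the least preorder with $\varphi\le\omega_A$, $\varphi\wedge\psi\le\varphi$, $\varphi\wedge\psi\le\psi$, $\varphi\le\varphi\wedge\varphi$, monotonicity of $\wedge$, and: $\omega_D\le\omega_D\to\omega_T$; $(\delta\to\tau)\wedge(\delta\to\tau')\le\delta\to(\tau\wedge\tau')$; $\langle\ell:\delta\rangle\wedge\langle\ell:\delta'\rangle\le\langle\ell:\delta\wedge\delta'\rangle$; $\omega_C\le\omega_D\times\omega_S$; $(\delta\times\sigma)\wedge(\delta'\times\sigma')\le(\delta\wedge\delta')\times(\sigma\wedge\sigma')$; $\omega_T\le\omega_S\to\omega_C$; $(\sigma\to\kappa)\wedge(\sigma\to\kappa')\le\sigma\to(\kappa\wedge\kappa')$; arrows contravariant in argument, covariant in result; $\times$ and $\langle\ell:\cdot\rangle$ covariant (if $\delta\le_D\delta'$ then $\langle\ell:\delta\rangle\le_S\langle\ell:\delta'\rangle$). $\mathrm{dom}(\langle\ell:\delta\rangle)=\{\ell\}$,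 $\mathrm{dom}(\sigma\wedge\sigma')=\mathrm{dom}(\sigma)\cup\mathrm{dom}(\sigma')$, $\mathrm{dom}(\omega_S)=\emptyset$. -}

module Defs where

open import Data.Nat using (ℕ)
open import Data.Sum using (_⊎_)
open import Data.Empty using (⊥)
open import Relation.Binary.PropositionalEquality using (_≡_)

Loc : Set
Loc = ℕ

data VType : Set
data SType : Set
data CType : Set
data TType : Set

data VType where
  _⇒_  : VType → TType → VType
  _∧D_ : VType → VType → VType
  ωD   : VType

data SType where
  ⟨_∶_⟩ : Loc → VType → SType
  _∧S_  : SType → SType → SType
  ωS    : SType

data CType where
  _⊗_  : VType → SType → CType
  _∧C_ : CType → CType → CType
  ωC   : CType

data TType where
  _⇛_  : SType → CType → TType
  _∧T_ : TType → TType → TType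
  ωT   : TType

infixr 6 _⇒_ _⇛_
infixl 7 _∧D_ _∧S_ _∧C_ _∧T_
infix 8 _⊗_

data _≤D_ : VType → VType → Set
data _≤S_ : SType → SType → Set
data _≤C_ : CType → CType → Set
data _≤T_ : TType → TType → Set

infix 4 _≤D_ _≤S_ _≤C_ _≤T_

data _≤D_ where
  reflD   : ∀ {δ} → δ ≤D δ
  transD  : ∀ {δ₁ δ₂ δ₃} → δ₁ ≤D δ₂ → δ₂ ≤D δ₃ → δ₁ ≤D δ₃
  ωD-top  : ∀ {δ} → δ ≤D ωD
  ∧D-lb₁  : ∀ {δ δ'} → δ ∧D δ' ≤D δ
  ∧D-lb₂  : ∀ {δ δ'} → δ ∧D δ' ≤D δ'
  ∧D-idem : ∀ {δ} → δ ≤D δ ∧D δ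
  ∧D-mono : ∀ {δ₁ δ₁' δ₂ δ₂'} → δ₁ ≤D δ₁' → δ₂ ≤D δ₂' → δ₁ ∧D δ₂ ≤D δ₁' ∧D δ₂'
  ωD-⇒    : ωD ≤D ωD ⇒ ωT
  ⇒-∧     : ∀ {δ τ τ'} → (δ ⇒ τ) ∧D (δ ⇒ τ') ≤D δ ⇒ (τ ∧T τ')
  ⇒-mono  : ∀ {δ δ' τ τ'} → δ' ≤D δ → τ ≤T τ' → δ ⇒ τ ≤D δ' ⇒ τ'

data _≤S_ where
  reflS   : ∀ {σ} → σ ≤S σ
  transS  : ∀ {σ₁ σ₂ σ₃} → σ₁ ≤S σ₂ → σ₂ ≤S σ₃ → σ₁ ≤S σ₃
  ωS-top  : ∀ {σ} → σ ≤S ωS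
  ∧S-lb₁  : ∀ {σ σ'} → σ ∧S σ' ≤S σ
  ∧S-lb₂  : ∀ {σ σ'} → σ ∧S σ' ≤S σ'
  ∧S-idem : ∀ {σ} → σ ≤S σ ∧S σ
  ∧S-mono : ∀ {σ₁ σ₁' σ₂ σ₂'} → σ₁ ≤S σ₁' → σ₂ ≤S σ₂' → σ₁ ∧S σ₂ ≤S σ₁' ∧S σ₂'
  loc-∧   : ∀ {ℓ δ δ'} → ⟨ ℓ ∶ δ ⟩ ∧S ⟨ ℓ ∶ δ' ⟩ ≤S ⟨ ℓ ∶ δ ∧D δ' ⟩
  loc-mono : ∀ {ℓ δ δ'} → δ ≤D δ' → ⟨ ℓ ∶ δ ⟩ ≤S ⟨ ℓ ∶ δ' ⟩

data _≤C_ where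
  reflC   : ∀ {κ} → κ ≤C κ
  transC  : ∀ {κ₁ κ₂ κ₃} → κ₁ ≤C κ₂ → κ₂ ≤C κ₃ → κ₁ ≤C κ₃
  ωC-top  : ∀ {κ} → κ ≤C ωC
  ∧C-lb₁  : ∀ {κ κ'} → κ ∧C κ' ≤C κ
  ∧C-lb₂  : ∀ {κ κ'} → κ ∧C κ' ≤C κ'
  ∧C-idem : ∀ {κ} → κ ≤C κ ∧C κ
  ∧C-mono : ∀ {κ₁ κ₁' κ₂ κ₂'} → κ₁ ≤C κ₁' → κ₂ ≤C κ₂' → κ₁ ∧C κ₂ ≤C κ₁' ∧C κ₂'
  ωC-⊗    : ωC ≤C ωD ⊗ ωS
  ⊗-∧     : ∀ {δ δ' σ σ'} → (δ ⊗ σ) ∧C (δ' ⊗ σ') ≤C (δ ∧D δ') ⊗ (σ ∧S σ')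
  ⊗-mono  : ∀ {δ δ' σ σ'} → δ ≤D δ' → σ ≤S σ' → δ ⊗ σ ≤C δ' ⊗ σ'

data _≤T_ where
  reflT   : ∀ {τ} → τ ≤T τ
  transT  : ∀ {τ₁ τ₂ τ₃} → τ₁ ≤T τ₂ → τ₂ ≤T τ₃ → τ₁ ≤T τ₃
  ωT-top  : ∀ {τ} → τ ≤T ωT
  ∧T-lb₁  : ∀ {τ τ'} → τ ∧T τ' ≤T τ
  ∧T-lb₂  : ∀ {τ τ'} → τ ∧T τ' ≤T τ'
  ∧T-idem : ∀ {τ} → τ ≤T τ ∧T τ
  ∧T-mono : ∀ {τ₁ τ₁' τ₂ τ₂'} → τ₁ ≤T τ₁' → τ₂ ≤T τ₂' → τ₁ ∧T τ₂ ≤T τ₁' ∧T τ₂'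
  ωT-⇛    : ωT ≤T ωS ⇛ ωC
  ⇛-∧     : ∀ {σ κ κ'} → (σ ⇛ κ) ∧T (σ ⇛ κ') ≤T σ ⇛ (κ ∧C κ')
  ⇛-mono  : ∀ {σ σ' κ κ'} → σ' ≤S σ → κ ≤C κ' → σ ⇛ κ ≤T σ' ⇛ κ'

_∈dom_ : Loc → SType → Set
ℓ ∈dom ⟨ ℓ' ∶ δ ⟩ = ℓ ≡ ℓ'
ℓ ∈dom (σ ∧S σ') = ℓ ∈dom σ ⊎ ℓ ∈dom σ'
ℓ ∈dom ωS = ⊥

infix 4 _∈dom_

_dom⊇_ : SType → SType → Set
σ dom⊇ σ' = ∀ ℓ → ℓ ∈dom σ' → ℓ ∈dom σ

module Submission where

open import Defs
open import Data.Sum using (inj₁; inj₂; [_,_]; map)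
open import Function using (id; _∘_)

-- Induction on the subtyping derivation: no rule of ≤S introduces on its
-- right-hand side a location absent from its left-hand side (loc-∧ and
-- loc-mono keep the location ℓ; ωS has empty domain).

dom⊇-trans : ∀ {σ₁ σ₂ σ₃} → σ₁ dom⊇ σ₂ → σ₂ dom⊇ σ₃ → σ₁ dom⊇ σ₃
dom⊇-trans p q ℓ = p ℓ ∘ q ℓ

dom⊇-∧-mono : ∀ {σ₁ σ₁' σ₂ σ₂'} →
  σ₁ dom⊇ σ₁' → σ₂ dom⊇ σ₂' → (σ₁ ∧S σ₂) dom⊇ (σ₁' ∧S σ₂')
dom⊇-∧-mono p q ℓ = map (p ℓ) (q ℓ)

≤S⇒dom⊇ : ∀ {σ σ'} → σ ≤S σ' → σ dom⊇ σ'
≤S⇒dom⊇ reflS _        = id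
≤S⇒dom⊇ (transS p q)   = dom⊇-trans (≤S⇒dom⊇ p) (≤S⇒dom⊇ q)
≤S⇒dom⊇ ωS-top _ ()
≤S⇒dom⊇ ∧S-lb₁ _       = inj₁
≤S⇒dom⊇ ∧S-lb₂ _       = inj₂
≤S⇒dom⊇ ∧S-idem _      = [ id , id ]
≤S⇒dom⊇ (∧S-mono p q)  = dom⊇-∧-mono (≤S⇒dom⊇ p) (≤S⇒dom⊇ q)
≤S⇒dom⊇ loc-∧ _        = inj₁
≤S⇒dom⊇ (loc-mono _) _ = id

mainTheorem17 : (σ σ' : SType) → σ ≤S σ' → σ dom⊇ σ'
mainTheorem17 _ _ = ≤S⇒dom⊇
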